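{- Let $e_1\neq e_2$ be edges of a digraph $G$ with $e_1 \text{ dom } e_2$ and $e_1 \text{ pdom } e_2$. Then any path from a source to a target of $G$ that traverses $e_2$ contains a cycle of the form $(e_1,\dots,e_2,\dots,e_1)$ (i.e. it traverses $e_1$, then $e_2$, then $e_1$ again).
   Context: All digraphs are finite; loops allowed, no multiple edges. A vertex is a source if it has no incoming non-loop edge and a target if it has no outgoing non-loop edge. For edges $x,y$: $x \text{ dom } y$ iff every path from a source of $G$ traversing $y$ passes through $x$; $x \text{ pdom } y$ iff $x$ dominates $y$ in the reversed digraph, i.e. every path from $y$ to a target of $G$ traverses $x$. -}

module Defs where

open import Data.Nat using (ℕ)
open import Data.Fin using (Fin)
open import Data.Bool using (Bool; true; false)
open import Data.Product using (_×_; _,_)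
open import Data.List using (List; []; _∷_)
open import Data.List.Membership.Propositional using (_∈_)
open import Data.List.Relation.Unary.Linked using (Linked)
open import Relation.Binary.PropositionalEquality using (_≡_; _≢_)

-- A finite digraph on vertex set Fin n: adjacency relation (loops allowed,
-- at most one edge u → v since edges are just ordered pairs).
Digraph : ℕ → Set
Digraph n = Fin n → Fin n → Bool

Edge : ℕ → Set
Edge n = Fin n × Fin n

IsEdge : {n : ℕ} → Digraph n → Edge n → Set
IsEdge G (u , v) = G u v ≡ true

rev : {n : ℕ} → Digraph n → Digraph n
rev G u v = G v u

revEdge : {n : ℕ} → Edge n → Edge n
revEdge (u , v) = (v , u)

IsSource : {n : ℕ} → Digraph n → Fin n → Set
IsSource G v = ∀ u → u ≢ v → G u v ≡ false

IsTarget : {n : ℕ} → Digraph n → Fin n → Set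
IsTarget G v = ∀ w → w ≢ v → G v w ≡ false

-- A path (walk, vertices/edges may repeat) is a nonempty vertex list
-- s ∷ vs with consecutive vertices adjacent.
IsPath : {n : ℕ} → Digraph n → Fin n → List (Fin n) → Set
IsPath G s vs = Linked (λ u v → G u v ≡ true) (s ∷ vs)

lastV : {A : Set} → A → List A → A
lastV s []       = s
lastV s (v ∷ vs) = lastV v vs

steps : {A : Set} → A → List A → List (A × A)
steps s []       = []
steps s (v ∷ vs) = (s , v) ∷ steps v vs

Dom : {n : ℕ} → Digraph n → Edge n → Edge n → Set
Dom G x y = ∀ s vs → IsPath G s vs → IsSource G s →
            y ∈ steps s vs → x ∈ steps s vs

PDom : {n : ℕ} → Digraph n → Edge n → Edge n → Set
PDom G x y = Dom (rev G) (revEdge x) (revEdge y)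

module Submission where

-- A dominator and a postdominator of the same edge must surround it.
--
-- Let P be a walk from a source s to a target t of G, and split P at an
-- occurrence of the step e₂ = (u , v):  s ∷ xs ++ v ∷ ys, with xs ending at u.
--   * The prefix s ∷ xs ++ [v] is a walk from a source that traverses e₂, so
--     by  e₁ dom e₂  it traverses e₁; as e₁ ≢ e₂, e₁ is a step of s ∷ xs.
--   * The suffix u ∷ v ∷ ys, read backwards, is a walk in the reversed graph
--     from t (a source there, since t is a target of G) that traverses the
--     reversal of e₂, so by  e₁ pdom e₂  it traverses the reversal of e₁;
--     hence e₁ is a step of u ∷ v ∷ ys, and as e₁ ≢ e₂, a step of v ∷ ys.
-- So the steps of P read  steps(s ∷ xs) ++ e₂ ∷ steps(v ∷ ys)  with e₁ in both
-- outer parts, which exhibits e₁ , e₂ , e₁ as a subsequence.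

open import Defs
open import Data.Nat using (ℕ)
open import Data.Fin using (Fin)
open import Data.List using (List; []; _∷_; _++_; map; reverse)
open import Data.List.Properties using (unfold-reverse)
open import Data.List.Membership.Propositional using (_∈_)
open import Data.List.Membership.Propositional.Properties using (∈-map⁺; ∈-map⁻; ∈-++⁻; ∈-++⁺ʳ)
open import Data.List.Relation.Unary.Any using (here; there)
open import Data.List.Relation.Unary.Any.Properties using (reverse⁺; reverse⁻)
open import Data.List.Relation.Unary.Linked using (Linked; [-]; _∷_; head)
open import Data.List.Relation.Binary.Sublist.Propositional using (_⊆_; _∷_; from∈)
open import Data.List.Relation.Binary.Sublist.Propositional.Properties using (++⁺)
open import Data.Product using (_×_; _,_; ∃; ∃₂; swap)
open import Data.Sum using (inj₁; inj₂)
open import Data.Empty using (⊥-elim)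
open import Function using (flip)
open import Relation.Binary.PropositionalEquality using (_≡_; _≢_; refl; sym; cong; cong₂; subst; module ≡-Reasoning)

module _ {A : Set} where

  lastV-++ : (s : A) (xs ys : List A) → lastV s (xs ++ ys) ≡ lastV (lastV s xs) ys
  lastV-++ s []       ys = refl
  lastV-++ s (x ∷ xs) ys = lastV-++ x xs ys

  steps-++ : (s : A) (xs ys : List A) →
             steps s (xs ++ ys) ≡ steps s xs ++ steps (lastV s xs) ys
  steps-++ s []       ys = refl
  steps-++ s (x ∷ xs) ys = cong ((s , x) ∷_) (steps-++ x xs ys)

  splitAtStep : ∀ {e : A × A} (s : A) (vs : List A) → e ∈ steps s vs →
                ∃₂ λ xs v → ∃ λ ys → vs ≡ xs ++ v ∷ ys × e ≡ (lastV s xs , v)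
  splitAtStep s (w ∷ vs) (here refl) = [] , w , vs , refl , refl
  splitAtStep s (w ∷ vs) (there m) with splitAtStep w vs m
  ... | xs , v , ys , refl , refl = w ∷ xs , v , ys , refl , refl

  module _ {R : A → A → Set} where

    walk-join : (s : A) (xs ys : List A) →
                Linked R (s ∷ xs) → Linked R (lastV s xs ∷ ys) → Linked R (s ∷ xs ++ ys)
    walk-join s []       ys _         w = w
    walk-join s (x ∷ xs) ys (r ∷ w₁) w₂ = r ∷ walk-join x xs ys w₁ w₂

    walk-prefix : (s : A) (xs ys : List A) → Linked R (s ∷ xs ++ ys) → Linked R (s ∷ xs)
    walk-prefix s []       ys _       = [-]
    walk-prefix s (x ∷ xs) ys (r ∷ w) = r ∷ walk-prefix x xs ys w

    walk-suffix : (s : A) (xs ys : List A) → Linked R (s ∷ xs ++ ys) → Linked R (lastV s xs ∷ ys)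
    walk-suffix s []       ys w       = w
    walk-suffix s (x ∷ xs) ys (r ∷ w) = walk-suffix x xs ys w

  -- The reversed walk: lastV s vs ∷ revWalk s vs  is  reverse (s ∷ vs).
  revWalk : A → List A → List A
  revWalk s []       = []
  revWalk s (v ∷ vs) = revWalk v vs ++ s ∷ []

  lastV-revWalk : (s : A) (vs : List A) → lastV (lastV s vs) (revWalk s vs) ≡ s
  lastV-revWalk s []       = refl
  lastV-revWalk s (v ∷ vs) = lastV-++ (lastV v vs) (revWalk v vs) (s ∷ [])

  steps-revWalk : (s : A) (vs : List A) →
                  steps (lastV s vs) (revWalk s vs) ≡ reverse (map swap (steps s vs))
  steps-revWalk s []       = refl
  steps-revWalk s (v ∷ vs) = begin
    steps t (revWalk v vs ++ s ∷ [])
      ≡⟨ steps-++ t (revWalk v vs) (s ∷ []) ⟩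
    steps t (revWalk v vs) ++ (lastV t (revWalk v vs) , s) ∷ []
      ≡⟨ cong₂ (λ L a → L ++ (a , s) ∷ []) (steps-revWalk v vs) (lastV-revWalk v vs) ⟩
    reverse (map swap (steps v vs)) ++ (v , s) ∷ []
      ≡⟨ unfold-reverse (v , s) (map swap (steps v vs)) ⟨
    reverse (map swap (steps s (v ∷ vs)))
      ∎
    where
    open ≡-Reasoning
    t = lastV v vs

  walk-reverse : ∀ {R : A → A → Set} (s : A) (vs : List A) →
                 Linked R (s ∷ vs) → Linked (flip R) (lastV s vs ∷ revWalk s vs)
  walk-reverse s []       _       = [-]
  walk-reverse s (v ∷ vs) (r ∷ w) =
    walk-join (lastV v vs) (revWalk v vs) (s ∷ []) (walk-reverse v vs w)
      (subst (λ a → Linked _ (a ∷ s ∷ [])) (sym (lastV-revWalk v vs)) (r ∷ [-]))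

  ∈-reverse-swap⁺ : ∀ {x : A × A} {L : List (A × A)} → x ∈ L → swap x ∈ reverse (map swap L)
  ∈-reverse-swap⁺ m = reverse⁺ (∈-map⁺ swap m)

  ∈-reverse-swap⁻ : ∀ {x : A × A} {L : List (A × A)} → swap x ∈ reverse (map swap L) → x ∈ L
  ∈-reverse-swap⁻ m with ∈-map⁻ swap (reverse⁻ m)
  ... | y , y∈L , sx≡sy = subst (_∈ _) (sym (cong swap sx≡sy)) y∈L

dominator-precedes : ∀ {n} (G : Digraph n) {e₁ : Edge n} (s : Fin n) (xs : List (Fin n))
  (v : Fin n) (ys : List (Fin n)) → let e₂ = (lastV s xs , v) in
  e₁ ≢ e₂ → Dom G e₁ e₂ →
  IsPath G s (xs ++ v ∷ ys) → IsSource G s → e₁ ∈ steps s xs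
dominator-precedes G {e₁} s xs v ys e₁≢e₂ dom walk source
  with ∈-++⁻ (steps s xs) (subst (e₁ ∈_) (steps-++ s xs (v ∷ [])) e₁∈prefix)
  where
  prefix : IsPath G s (xs ++ v ∷ [])
  prefix = walk-join s xs (v ∷ []) (walk-prefix s xs (v ∷ ys) walk)
             (head (walk-suffix s xs (v ∷ ys) walk) ∷ [-])
  e₂∈prefix : (lastV s xs , v) ∈ steps s (xs ++ v ∷ [])
  e₂∈prefix = subst ((lastV s xs , v) ∈_) (sym (steps-++ s xs (v ∷ []))) (∈-++⁺ʳ (steps s xs) (here refl))
  e₁∈prefix : e₁ ∈ steps s (xs ++ v ∷ [])
  e₁∈prefix = dom s (xs ++ v ∷ []) prefix source e₂∈prefix
... | inj₁ before     = before
... | inj₂ (here e₁≡e₂) = ⊥-elim (e₁≢e₂ e₁≡e₂)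

-- Dually, if e₁ ≢ e₂ postdominates e₂, then on a walk to a target, any
-- occurrence of e₂ is followed by e₁: reversing the rest of the walk
-- gives a walk from a source of the reversed graph through the reversal of e₂.
-- (A target of G is, by definition, a source of rev G.)
postdominator-follows : ∀ {n} (G : Digraph n) {e₁ : Edge n} (u v : Fin n) (ys : List (Fin n)) →
  e₁ ≢ (u , v) → PDom G e₁ (u , v) →
  IsPath G u (v ∷ ys) → IsTarget G (lastV v ys) → e₁ ∈ steps v ys
postdominator-follows G {e₁} u v ys e₁≢e₂ pdom walk target
  with ∈-reverse-swap⁻ {L = steps u (v ∷ ys)} (subst (revEdge e₁ ∈_) (steps-revWalk u (v ∷ ys)) e₁∈reversed)
  where
  reversed : IsPath (rev G) (lastV v ys) (revWalk u (v ∷ ys))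
  reversed = walk-reverse u (v ∷ ys) walk
  e₂∈reversed : revEdge (u , v) ∈ steps (lastV v ys) (revWalk u (v ∷ ys))
  e₂∈reversed = subst (revEdge (u , v) ∈_) (sym (steps-revWalk u (v ∷ ys)))
                  (∈-reverse-swap⁺ {L = steps u (v ∷ ys)} (here refl))
  e₁∈reversed : revEdge e₁ ∈ steps (lastV v ys) (revWalk u (v ∷ ys))
  e₁∈reversed = pdom (lastV v ys) (revWalk u (v ∷ ys)) reversed target e₂∈reversed
... | here e₁≡e₂ = ⊥-elim (e₁≢e₂ e₁≡e₂)
... | there after = after

mainTheorem4 : (n : ℕ) (G : Digraph n) (e₁ e₂ : Edge n) →
    IsEdge G e₁ → IsEdge G e₂ → e₁ ≢ e₂ →
    Dom G e₁ e₂ → PDom G e₁ e₂ →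
    ∀ s vs → IsPath G s vs → IsSource G s → IsTarget G (lastV s vs) →
    e₂ ∈ steps s vs →
    (e₁ ∷ e₂ ∷ e₁ ∷ []) ⊆ steps s vs
mainTheorem4 _ G e₁ e₂ _ _ e₁≢e₂ dom pdom s vs walk source target e₂∈walk
  with splitAtStep s vs e₂∈walk
... | xs , v , ys , refl , refl =
  subst ((e₁ ∷ e₂ ∷ e₁ ∷ []) ⊆_) (sym (steps-++ s xs (v ∷ ys)))
    (++⁺ (from∈ before) (refl ∷ from∈ after))
  where
  before : e₁ ∈ steps s xs
  before = dominator-precedes G s xs v ys e₁≢e₂ dom walk source
  after : e₁ ∈ steps v ys
  after = postdominator-follows G (lastV s xs) v ys e₁≢e₂ pdom
            (walk-suffix s xs (v ∷ ys) walk)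
            (subst (IsTarget G) (lastV-++ s xs (v ∷ ys)) target)
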